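{- If $G=(V,E)$ is probe diamond-free, then $G$ is LUCS.
   Context: A diamond is $K_4$ minus one edge. A graph $G=(V,E)$ is probe diamond-free if $V$ admits a partition $V=P\cup N$ with $N$ an independent set, and there is a set $F$ of non-edges of $G$ with both endpoints in $N$ such that $(V,E\cup F)$ has no induced diamond. A graph is complete split if its vertex set can be partitioned into a clique $K$ and a maximum independent set $S$ with every vertex of $K$ adjacent to every vertex of $S$. $G$ is LUCS (locally union of complete split) if for every vertex $v$, every connected component of $G[N(v)]$ is complete split. -}

module Defs where

open import Data.Nat using (ℕ; _≤_)
open import Data.Bool using (Bool; true; false; _∨_)
open import Data.Fin using (Fin)
open import Data.Fin.Subset using (Subset; _∈_; _∉_; _⊆_; ∣_∣)
open import Data.Product using (Σ; ∃; _×_; _,_)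
open import Data.Sum using (_⊎_)
open import Relation.Nullary using (¬_)
open import Relation.Binary.PropositionalEquality using (_≡_; _≢_)

AdjRel : ℕ → Set
AdjRel n = Fin n → Fin n → Bool

record Graph (n : ℕ) : Set where
  field
    adj   : AdjRel n
    sym   : ∀ u v → adj u v ≡ adj v u
    irrefl : ∀ u → adj u u ≡ false

open Graph public

Adj : ∀ {n} → AdjRel n → Fin n → Fin n → Set
Adj A u v = A u v ≡ true

-- A has an induced diamond (K4 minus an edge): vertices a,b,c,d with
-- ab, ac, ad, bc, bd edges and cd a non-edge, c ≠ d (the other
-- distinctnesses follow from looplessness).
HasInducedDiamond : ∀ {n} → AdjRel n → Set
HasInducedDiamond {n} A =
  Σ (Fin n) λ a → Σ (Fin n) λ b → Σ (Fin n) λ c → Σ (Fin n) λ d →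
    Adj A a b × Adj A a c × Adj A a d × Adj A b c × Adj A b d ×
    c ≢ d × ¬ Adj A c d

_∪E_ : ∀ {n} → Graph n → AdjRel n → AdjRel n
(G ∪E F) u v = adj G u v ∨ F u v

Independent : ∀ {n} → Graph n → Subset n → Set
Independent G S = ∀ u v → u ∈ S → v ∈ S → ¬ Adj (adj G) u v

Clique : ∀ {n} → Graph n → Subset n → Set
Clique G K = ∀ u v → u ∈ K → v ∈ K → u ≢ v → Adj (adj G) u v

-- G is probe diamond-free: there is a partition V = P ∪ N (given by N,
-- P being its complement) with N independent, and a set F of non-edges
-- of G (symmetric, between distinct vertices) with both endpoints in N,
-- such that (V, E ∪ F) has no induced diamond.
ProbeDiamondFree : ∀ {n} → Graph n → Set
ProbeDiamondFree {n} G =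
  Σ (Subset n) λ N → Independent G N ×
  Σ (AdjRel n) λ F →
    (∀ u v → F u v ≡ F v u) ×
    (∀ u v → Adj F u v → u ≢ v × u ∈ N × v ∈ N × ¬ Adj (adj G) u v) ×
    ¬ HasInducedDiamond (G ∪E F)

Nbhd : ∀ {n} → Graph n → Fin n → Subset n → Set
Nbhd G v S = ∀ u → (u ∈ S → Adj (adj G) v u) × (Adj (adj G) v u → u ∈ S)

data WalkIn {n} (G : Graph n) (S : Subset n) : Fin n → Fin n → Set where
  here : ∀ {u} → u ∈ S → WalkIn G S u u
  step : ∀ {u x w} → u ∈ S → Adj (adj G) u x → WalkIn G S x w → WalkIn G S u w

IsComponent : ∀ {n} → Graph n → Subset n → Subset n → Set
IsComponent {n} G S C =
  Σ (Fin n) λ w → w ∈ S ×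
    (∀ u → (u ∈ C → WalkIn G S w u) × (WalkIn G S w u → u ∈ C))

CompleteSplit : ∀ {n} → Graph n → Subset n → Set
CompleteSplit {n} G C =
  Σ (Subset n) λ K → Σ (Subset n) λ I →
    (∀ u → (u ∈ C → u ∈ K ⊎ u ∈ I) × (u ∈ K → u ∈ C) × (u ∈ I → u ∈ C)) ×
    (∀ u → u ∈ K → u ∉ I) ×
    Clique G K ×
    Independent G I ×
    (∀ T → T ⊆ C → Independent G T → ∣ T ∣ ≤ ∣ I ∣) ×
    (∀ u v → u ∈ K → v ∈ I → Adj (adj G) u v)

LUCS : ∀ {n} → Graph n → Set
LUCS {n} G = ∀ v S C → Nbhd G v S → IsComponent G S C → CompleteSplit G C

{-# OPTIONS --safe #-}
-- Let H = G ∪ F, which is diamond-free. If b ∈ N(v) is H-adjacent to a, c ∈ N(v) with a ≠ c,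
-- then a and c are H-adjacent, as otherwise v, b, a, c induce a diamond; so every component C of
-- G[N(v)] is a clique of H. The edges of F only join vertices of N, hence every vertex of C
-- outside N is adjacent in G to all of C. Thus C ∖ N is a clique completely joined to the
-- independent set C ∩ N, which is maximum in G[C] because an independent set meeting C ∖ N is a
-- single vertex. If C ∩ N is empty, C is a clique of G and any single vertex plays its role.
module Submission where

open import Data.Nat using (ℕ; _≤_)
open import Data.Nat.Properties using (module ≤-Reasoning)
open import Data.Bool using (true; false; _∨_) renaming (_≟_ to _≟ᵇ_)
open import Data.Fin using (Fin; _≟_)
open import Data.Fin.Subset using (Subset; _∈_; _∉_; _⊆_; ∣_∣; ⁅_⁆; _∩_; ∁; Nonempty)
open import Data.Fin.Subset.Properties
  using (_∈?_; nonempty?; x∈⁅x⁆; x∈⁅y⁆⇒x≡y; ∣⁅x⁆∣≡1; p⊆q⇒∣p∣≤∣q∣; p∩q⊆p;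
         x∈p∩q⁺; x∈p∩q⁻; x∈∁p⇒x∉p; x∉p⇒x∈∁p)
open import Data.Product using (_×_; _,_; proj₁; proj₂)
open import Data.Sum using (_⊎_; inj₁; inj₂)
open import Relation.Nullary using (¬_; yes; no; contradiction)
open import Relation.Nullary.Decidable using (decidable-stable)
open import Relation.Binary.PropositionalEquality
  using (_≡_; _≢_; refl; trans; subst; cong₂; ≢-sym)
  renaming (sym to ≡-sym)
open import Defs

private variable
  n : ℕ

Universal : Graph n → Subset n → Fin n → Set
Universal G C u = ∀ x → x ∈ C → x ≢ u → Adj (adj G) u x

UniversalOutside : Graph n → Subset n → Subset n → Set
UniversalOutside G C J = ∀ {u} → u ∈ C → u ∉ J → Universal G C u

singleton-independent : (G : Graph n) (w : Fin n) → Independent G ⁅ w ⁆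
singleton-independent G w a b a∈⁅w⁆ b∈⁅w⁆ ab
  with refl ← x∈⁅y⁆⇒x≡y w a∈⁅w⁆ | refl ← x∈⁅y⁆⇒x≡y w b∈⁅w⁆
  = contradiction (trans (≡-sym (irrefl G a)) ab) λ ()

⁅⁆⊆ : ∀ {x} {p : Subset n} → x ∈ p → ⁅ x ⁆ ⊆ p
⁅⁆⊆ {x = x} x∈p y∈⁅x⁆ = subst (_∈ _) (≡-sym (x∈⁅y⁆⇒x≡y x y∈⁅x⁆)) x∈p

module _ (G : Graph n) (C : Subset n) where

  independent-∋-universal⇒⊆⁅⁆ : ∀ {T k} → T ⊆ C → Independent G T →
                                 k ∈ T → Universal G C k → T ⊆ ⁅ k ⁆
  independent-∋-universal⇒⊆⁅⁆ {k = k} T⊆C T-indep k∈T k-univ {x} x∈T with x ≟ k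
  ... | yes refl = x∈⁅x⁆ k
  ... | no x≢k   = contradiction (k-univ x (T⊆C x∈T) x≢k) (T-indep k x k∈T x∈T)

  universalOutside⊆⇒completeSplit : (I : Subset n) → I ⊆ C → Nonempty I → Independent G I →
                                    UniversalOutside G C I → CompleteSplit G C
  universalOutside⊆⇒completeSplit I I⊆C (i , i∈I) I-indep outside-universal =
    K , I , partition , K∌I , K-clique , I-indep , I-maximum , K-I-join
    where
    K : Subset n
    K = C ∩ ∁ I

    K⊆C : K ⊆ C
    K⊆C = p∩q⊆p C (∁ I)

    K∌I : ∀ u → u ∈ K → u ∉ I
    K∌I u u∈K = x∈∁p⇒x∉p (proj₂ (x∈p∩q⁻ C (∁ I) u∈K))

    K-universal : ∀ {u} → u ∈ K → Universal G C u
    K-universal u∈K = outside-universal (K⊆C u∈K) (K∌I _ u∈K)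

    partition : ∀ u → (u ∈ C → u ∈ K ⊎ u ∈ I) × (u ∈ K → u ∈ C) × (u ∈ I → u ∈ C)
    partition u = K-or-I , K⊆C , I⊆C
      where
      K-or-I : u ∈ C → u ∈ K ⊎ u ∈ I
      K-or-I u∈C with u ∈? I
      ... | yes u∈I = inj₂ u∈I
      ... | no u∉I  = inj₁ (x∈p∩q⁺ (u∈C , x∉p⇒x∈∁p u∉I))

    K-clique : Clique G K
    K-clique u x u∈K x∈K u≢x = K-universal u∈K x (K⊆C x∈K) (≢-sym u≢x)

    K-I-join : ∀ u x → u ∈ K → x ∈ I → Adj (adj G) u x
    K-I-join u x u∈K x∈I =
      K-universal u∈K x (I⊆C x∈I) λ x≡u → K∌I u u∈K (subst (_∈ I) x≡u x∈I)

    I-maximum : ∀ T → T ⊆ C → Independent G T → ∣ T ∣ ≤ ∣ I ∣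
    I-maximum T T⊆C T-indep with nonempty? (T ∩ ∁ I)
    ... | yes (k , k∈T∖I) = begin
      ∣ T ∣      ≤⟨ p⊆q⇒∣p∣≤∣q∣ T⊆⁅k⁆ ⟩
      ∣ ⁅ k ⁆ ∣  ≡⟨ ∣⁅x⁆∣≡1 k ⟩
      1          ≡⟨ ∣⁅x⁆∣≡1 i ⟨
      ∣ ⁅ i ⁆ ∣  ≤⟨ p⊆q⇒∣p∣≤∣q∣ (⁅⁆⊆ i∈I) ⟩
      ∣ I ∣      ∎
      where
      open ≤-Reasoning
      T⊆⁅k⁆ : T ⊆ ⁅ k ⁆
      T⊆⁅k⁆ = let k∈T , k∈∁I = x∈p∩q⁻ T (∁ I) k∈T∖I in
        independent-∋-universal⇒⊆⁅⁆ T⊆C T-indep k∈T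
          (outside-universal (T⊆C k∈T) (x∈∁p⇒x∉p k∈∁I))
    ... | no T∖I-empty = p⊆q⇒∣p∣≤∣q∣ λ {x} x∈T →
      decidable-stable (x ∈? I) λ x∉I → T∖I-empty (x , x∈p∩q⁺ (x∈T , x∉p⇒x∈∁p x∉I))

  universalOutside⇒completeSplit : (J : Subset n) → Independent G J → UniversalOutside G C J →
                                   Nonempty C → CompleteSplit G C
  universalOutside⇒completeSplit J J-indep outside-universal (w , w∈C)
    with nonempty? (C ∩ J)
  ... | yes C∩J-nonempty =
    universalOutside⊆⇒completeSplit (C ∩ J) (p∩q⊆p C J) C∩J-nonempty C∩J-indep
      λ u∈C u∉C∩J → outside-universal u∈C λ u∈J → u∉C∩J (x∈p∩q⁺ (u∈C , u∈J))
    where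
    C∩J-indep : Independent G (C ∩ J)
    C∩J-indep a b a∈ b∈ = J-indep a b (proj₂ (x∈p∩q⁻ C J a∈)) (proj₂ (x∈p∩q⁻ C J b∈))
  ... | no C∩J-empty =
    universalOutside⊆⇒completeSplit ⁅ w ⁆ (⁅⁆⊆ w∈C) (w , x∈⁅x⁆ w) (singleton-independent G w)
      λ u∈C _ → outside-universal u∈C λ u∈J → C∩J-empty (_ , x∈p∩q⁺ (u∈C , u∈J))

diamondFree⇒nbhd-transitive : {A : AdjRel n} → ¬ HasInducedDiamond A → ∀ {v a b c} →
                              Adj A v a → Adj A v b → Adj A v c →
                              Adj A b a → Adj A b c → a ≢ c → Adj A a c
diamondFree⇒nbhd-transitive {A = A} noDiamond {v} {a} {b} {c} va vb vc ba bc a≢c =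
  decidable-stable (A a c ≟ᵇ true) λ ¬ac →
    noDiamond (v , b , a , c , vb , va , vc , ba , bc , a≢c , ¬ac)

walkIn-source : ∀ {G : Graph n} {S a b} → WalkIn G S a b → a ∈ S
walkIn-source (here a∈S)     = a∈S
walkIn-source (step a∈S _ _) = a∈S

walkIn-target : ∀ {G : Graph n} {S a b} → WalkIn G S a b → b ∈ S
walkIn-target (here b∈S)  = b∈S
walkIn-target (step _ _ p) = walkIn-target p

component⊆ : ∀ {G : Graph n} {S C} → IsComponent G S C → C ⊆ S
component⊆ (_ , _ , reach) x∈C = walkIn-target (proj₁ (reach _) x∈C)

component-nonempty : ∀ {G : Graph n} {S C} → IsComponent G S C → Nonempty C
component-nonempty (w , w∈S , reach) = w , proj₂ (reach w) (here w∈S)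

module _ {G : Graph n} {A : AdjRel n}
         (G⊆A : ∀ {u v} → Adj (adj G) u v → Adj A u v)
         (A-sym : ∀ {u v} → Adj A u v → Adj A v u)
         (A-diamondFree : ¬ HasInducedDiamond A)
         {v : Fin n} {S : Subset n} (S⊆N[v] : ∀ {u} → u ∈ S → Adj A v u) where

  walkIn⇒≡⊎adj : ∀ {a b} → WalkIn G S a b → a ≡ b ⊎ Adj A a b
  walkIn⇒≡⊎adj (here _) = inj₁ refl
  walkIn⇒≡⊎adj {a} {b} (step a∈S ax p) with walkIn⇒≡⊎adj p | a ≟ b
  ... | inj₁ refl | _       = inj₂ (G⊆A ax)
  ... | inj₂ _    | yes a≡b = inj₁ a≡b
  ... | inj₂ xb   | no a≢b  =
    inj₂ (diamondFree⇒nbhd-transitive A-diamondFree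
            (S⊆N[v] a∈S) (S⊆N[v] (walkIn-source p)) (S⊆N[v] (walkIn-target p))
            (A-sym (G⊆A ax)) xb a≢b)

  component⇒clique : ∀ {C} → IsComponent G S C →
                     ∀ {x y} → x ∈ C → y ∈ C → x ≢ y → Adj A x y
  component⇒clique C-comp@(w , w∈S , reach) {x} {y} x∈C y∈C x≢y
    with walkIn⇒≡⊎adj (proj₁ (reach x) x∈C) | walkIn⇒≡⊎adj (proj₁ (reach y) y∈C)
  ... | inj₁ refl | inj₁ refl = contradiction refl x≢y
  ... | inj₁ refl | inj₂ wy   = wy
  ... | inj₂ wx   | inj₁ refl = A-sym wx
  ... | inj₂ wx   | inj₂ wy   =
    diamondFree⇒nbhd-transitive A-diamondFree
      (S⊆N[v] (component⊆ C-comp x∈C)) (S⊆N[v] w∈S) (S⊆N[v] (component⊆ C-comp y∈C))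
      wx wy x≢y

module _ (G : Graph n) (F : AdjRel n) where

  ∪E-adj⁺ˡ : ∀ {u v} → Adj (adj G) u v → Adj (G ∪E F) u v
  ∪E-adj⁺ˡ uv rewrite uv = refl

  ∪E-adj⁻ : ∀ {u v} → Adj (G ∪E F) u v → Adj (adj G) u v ⊎ Adj F u v
  ∪E-adj⁻ {u} {v} uv with adj G u v
  ... | true  = inj₁ refl
  ... | false = inj₂ uv

  ∪E-sym : (∀ u v → F u v ≡ F v u) → ∀ {u v} → Adj (G ∪E F) u v → Adj (G ∪E F) v u
  ∪E-sym F-sym {u} {v} = trans (cong₂ _∨_ (sym G v u) (F-sym v u))

  ∪E-clique⇒universal-outside :
    ∀ {N C} → (∀ u v → Adj F u v → u ∈ N) →
    (∀ {x y} → x ∈ C → y ∈ C → x ≢ y → Adj (G ∪E F) x y) →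
    UniversalOutside G C N
  ∪E-clique⇒universal-outside F⊆N C-clique u∈C u∉N x x∈C x≢u
    with ∪E-adj⁻ (C-clique u∈C x∈C (≢-sym x≢u))
  ... | inj₁ ux = ux
  ... | inj₂ ux = contradiction (F⊆N _ x ux) u∉N

lemma4 : ∀ (n : ℕ) (G : Graph n) → ProbeDiamondFree G → LUCS G
lemma4 n G (N , N-indep , F , F-sym , F-probe , noDiamond) v S C S-nbhd C-component =
  universalOutside⇒completeSplit G C N N-indep
    (∪E-clique⇒universal-outside G F F-inside-N
      (component⇒clique (∪E-adj⁺ˡ G F) (∪E-sym G F F-sym) noDiamond S⊆N[v] C-component))
    (component-nonempty C-component)
  where
  F-inside-N : ∀ u x → Adj F u x → u ∈ N
  F-inside-N u x ux = proj₁ (proj₂ (F-probe u x ux))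

  S⊆N[v] : ∀ {u} → u ∈ S → Adj (G ∪E F) v u
  S⊆N[v] u∈S = ∪E-adj⁺ˡ G F (proj₁ (S-nbhd _) u∈S)
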